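{- Let $H$ be a graph containing distinct vertices $u,v,w$ with $N_H(v)=\{u,w\}$ and $N_H(w)=\{v\}$, and let $H'=H-w-v$. If $\mathcal{D}(H')$ has a Hamilton path, then $\mathcal{D}(H)$ has a Hamilton path.
   Context: All graphs are finite and simple; $N_H(y)$ denotes the set of neighbours of $y$ in $H$, and $H-w-v$ is the graph obtained by deleting vertices $w$ and $v$. For a graph $H$, a dominating set of $H$ is a set $D\subseteq V(H)$ such that every vertex of $V(H)\setminus D$ is adjacent to a vertex of $D$. The dominating graph $\mathcal{D}(H)$ is the graph whose vertices are all dominating sets of $H$, in which two distinct dominating sets $X,Y$ are adjacent if and only if $|X\triangle Y|=1$. -}

module Defs where

open import Data.Nat using (ℕ; suc)
open import Data.Bool using (Bool; true; false)
open import Data.Fin using (Fin; punchIn; punchOut)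
open import Data.Fin.Subset using (Subset; _∈_; _∪_; _─_; ∣_∣)
open import Data.Product using (Σ; ∃; _×_)
open import Data.Sum using (_⊎_)
open import Data.List using (List)
open import Data.List.Relation.Unary.All using (All)
open import Data.List.Relation.Unary.Linked using (Linked)
open import Data.List.Relation.Unary.Unique.Propositional using (Unique)
open import Data.List.Membership.Propositional using () renaming (_∈_ to _∈ˡ_)
open import Relation.Binary.PropositionalEquality using (_≡_; _≢_)

record Graph (n : ℕ) : Set where
  field
    Adj    : Fin n → Fin n → Bool
    sym    : ∀ i j → Adj i j ≡ Adj j i
    irrefl : ∀ i → Adj i i ≡ false
open Graph public

_∼[_]_ : ∀ {n} → Fin n → Graph n → Fin n → Set
x ∼[ H ] y = Adj H x y ≡ true

deleteVertex : ∀ {n} → Graph (suc n) → Fin (suc n) → Graph n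
deleteVertex H i = record
  { Adj    = λ a b → Adj H (punchIn i a) (punchIn i b)
  ; sym    = λ a b → sym H (punchIn i a) (punchIn i b)
  ; irrefl = λ a → irrefl H (punchIn i a)
  }

deleteTwo : ∀ {n} (H : Graph (suc (suc n))) (w v : Fin (suc (suc n))) →
            w ≢ v → Graph n
deleteTwo H w v w≢v = deleteVertex (deleteVertex H w) (punchOut w≢v)

Dominating : ∀ {n} → Graph n → Subset n → Set
Dominating H D = ∀ x → x ∈ D ⊎ ∃ λ y → y ∈ D × x ∼[ H ] y

_△_ : ∀ {n} → Subset n → Subset n → Subset n
X △ Y = (X ─ Y) ∪ (Y ─ X)

-- adjacency in the dominating graph 𝒟(H): |X △ Y| = 1
-- (this forces X ≠ Y)
DomAdj : ∀ {n} → Subset n → Subset n → Set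
DomAdj X Y = ∣ X △ Y ∣ ≡ 1

HamiltonPathDom : ∀ {n} → Graph n → Set
HamiltonPathDom {n} H =
  Σ (List (Subset n)) λ p →
    All (Dominating H) p ×
    Unique p ×
    (∀ D → Dominating H D → D ∈ˡ p) ×
    Linked DomAdj p

-- A dominating set X of H is its trace D on H′ = H - w - v together with the
-- membership bits of w and v; since w must be dominated, X meets {w, v}. Each
-- dominating set D of H′ gets a column of dominating sets of H: D + w, D + w + v,
-- D + v and, when D − u fails to dominate H′ although D − u + v dominates H
-- (v then covers u), also D − u + w + v and D − u + v. The column is a path in
-- 𝒟(H) from D + w to D + v, and every dominating set of H lies in exactly one
-- column. Traversing the columns along a Hamilton path of 𝒟(H′), alternately
-- forwards and backwards, gives a Hamilton path of 𝒟(H): consecutive columns are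
-- joined by D + w ~ D′ + w or D + v ~ D′ + v.
module Submission where

open import Data.Bool using (Bool; true; false; not; _xor_)
open import Data.Bool.Properties using (xor-same; xor-inverseʳ)
open import Data.Empty using (⊥-elim)
open import Data.Fin using (Fin; zero; suc; punchIn; punchOut; _≟_)
open import Data.Fin.Properties using (punchIn-injective; punchInᵢ≢i; punchIn-punchOut; any?; all?)
open import Data.Fin.Subset using (Subset; inside; outside; _∈_; _∉_; _⊆_; _∪_; _─_; _-_; ⁅_⁆; ⊥; ∣_∣)
open import Data.Fin.Subset.Properties using (_∈?_; ∪-comm; ∣⊥∣≡0; ∣⁅x⁆∣≡1; p─⊥≡p; ∪-identityʳ; x∈p⇒p-x⊂p; p⊆p∪q; x∈p∪q⁺; x∈⁅x⁆)
open import Data.List using (List; []; _∷_; _++_; head; last)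
open import Data.List.Membership.Propositional using () renaming (_∈_ to _∈ˡ_)
open import Data.List.Membership.Propositional.Properties using (∈-++⁺ˡ; ∈-++⁺ʳ)
open import Data.List.Relation.Unary.All as All using (All; []; _∷_)
open import Data.List.Relation.Unary.All.Properties using () renaming (++⁺ to All-++⁺)
open import Data.List.Relation.Unary.AllPairs using ([]; _∷_)
open import Data.List.Relation.Unary.AllPairs.Properties using () renaming (++⁺ to AllPairs-++⁺)
open import Data.List.Relation.Unary.Any as Any using ()
open import Data.List.Relation.Unary.Linked using (Linked; []; [-]; _∷_)
open import Data.List.Relation.Unary.Linked.Properties using () renaming (++⁺ to Linked-++⁺)
open import Data.List.Relation.Unary.Unique.Propositional using (Unique)
open import Data.Maybe using (just; nothing)
open import Data.Maybe.Relation.Binary.Connected using (Connected; just; just-nothing)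
open import Data.Nat using (ℕ; suc)
open import Data.Product using (∃; _×_; _,_; proj₁; proj₂)
open import Data.Sum using (_⊎_; inj₁; inj₂)
open import Data.Vec using ([]; _∷_; here; there; lookup; insertAt; removeAt)
open import Data.Vec.Properties using (insertAt-lookup; insertAt-punchIn; removeAt-insertAt; insertAt-removeAt; removeAt-punchOut; []=⇒lookup; lookup⇒[]=)
open import Function.Base using (_∘_)
open import Function.Bundles using (_⇔_; Equivalence)
open import Relation.Binary.PropositionalEquality using (_≡_; _≢_; refl; sym; trans; cong; subst; subst₂; cong₂; ≢-sym; module ≡-Reasoning)
open import Relation.Nullary using (Dec; yes; no; ¬_)
open import Relation.Nullary.Decidable using (_⊎-dec_; _×-dec_; ¬?)
import Data.Bool as Bool

open import Defs hiding (sym)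

private
  variable
    n : ℕ

△-comm : (p q : Subset n) → p △ q ≡ q △ p
△-comm p q = ∪-comm (p ─ q) (q ─ p)

p△p≡⊥ : (p : Subset n) → p △ p ≡ ⊥
p△p≡⊥ []            = refl
p△p≡⊥ (inside  ∷ p) = cong (outside ∷_) (p△p≡⊥ p)
p△p≡⊥ (outside ∷ p) = cong (outside ∷_) (p△p≡⊥ p)

insertAt-△ : (p q : Subset n) (i : Fin (suc n)) (s t : Bool) →
             insertAt p i s △ insertAt q i t ≡ insertAt (p △ q) i (s xor t)
insertAt-△ p       q       zero    true  true  = refl
insertAt-△ p       q       zero    true  false = refl
insertAt-△ p       q       zero    false true  = refl
insertAt-△ p       q       zero    false false = refl
insertAt-△ (_ ∷ p) (_ ∷ q) (suc i) s     t     = cong (_ ∷_) (insertAt-△ p q i s t)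

∣insertAt∣ : (p : Subset n) (i : Fin (suc n)) (s : Bool) → ∣ insertAt p i s ∣ ≡ ∣ s ∷ p ∣
∣insertAt∣ p             zero    s       = refl
∣insertAt∣ (inside  ∷ p) (suc i) inside  = cong suc (∣insertAt∣ p i inside)
∣insertAt∣ (inside  ∷ p) (suc i) outside = cong suc (∣insertAt∣ p i outside)
∣insertAt∣ (outside ∷ p) (suc i) s       = ∣insertAt∣ p i s

x∈p⇒p△p-x≡⁅x⁆ : {x : Fin n} {p : Subset n} → x ∈ p → p △ (p - x) ≡ ⁅ x ⁆
x∈p⇒p△p-x≡⁅x⁆ {p = inside  ∷ p} here        = cong (inside ∷_) (trans (cong (p △_) (p─⊥≡p p)) (p△p≡⊥ p))
x∈p⇒p△p-x≡⁅x⁆ {p = inside  ∷ p} (there x∈p) = cong (outside ∷_) (x∈p⇒p△p-x≡⁅x⁆ x∈p)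
x∈p⇒p△p-x≡⁅x⁆ {p = outside ∷ p} (there x∈p) = cong (outside ∷_) (x∈p⇒p△p-x≡⁅x⁆ x∈p)

x∉p⇒p-x≡p : {x : Fin n} {p : Subset n} → x ∉ p → p - x ≡ p
x∉p⇒p-x≡p {x = zero}  {inside  ∷ p} x∉p = ⊥-elim (x∉p here)
x∉p⇒p-x≡p {x = zero}  {outside ∷ p} x∉p = cong (outside ∷_) (p─⊥≡p p)
x∉p⇒p-x≡p {x = suc x} {s ∷ p}       x∉p = cong (s ∷_) (x∉p⇒p-x≡p (λ x∈p → x∉p (there x∈p)))

x∈p⇒p-x∪⁅x⁆≡p : {x : Fin n} {p : Subset n} → x ∈ p → (p - x) ∪ ⁅ x ⁆ ≡ p
x∈p⇒p-x∪⁅x⁆≡p {p = inside  ∷ p} here        = cong (inside ∷_) (trans (∪-identityʳ (p ─ ⊥)) (p─⊥≡p p))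
x∈p⇒p-x∪⁅x⁆≡p {p = inside  ∷ p} (there x∈p) = cong (inside  ∷_) (x∈p⇒p-x∪⁅x⁆≡p x∈p)
x∈p⇒p-x∪⁅x⁆≡p {p = outside ∷ p} (there x∈p) = cong (outside ∷_) (x∈p⇒p-x∪⁅x⁆≡p x∈p)

x∉p⇒p∪⁅x⁆-x≡p : {x : Fin n} {p : Subset n} → x ∉ p → (p ∪ ⁅ x ⁆) - x ≡ p
x∉p⇒p∪⁅x⁆-x≡p {x = zero}  {inside  ∷ p} x∉p = ⊥-elim (x∉p here)
x∉p⇒p∪⁅x⁆-x≡p {x = zero}  {outside ∷ p} x∉p = cong (outside ∷_) (trans (p─⊥≡p (p ∪ ⊥)) (∪-identityʳ p))
x∉p⇒p∪⁅x⁆-x≡p {x = suc x} {inside  ∷ p} x∉p = cong (inside ∷_) (x∉p⇒p∪⁅x⁆-x≡p (λ x∈p → x∉p (there x∈p)))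
x∉p⇒p∪⁅x⁆-x≡p {x = suc x} {outside ∷ p} x∉p = cong (outside ∷_) (x∉p⇒p∪⁅x⁆-x≡p (λ x∈p → x∉p (there x∈p)))

x∈p⇒p≢p-x : {x : Fin n} {p : Subset n} → x ∈ p → p ≢ p - x
x∈p⇒p≢p-x x∈p p≡p-x =
  let _ , y , y∈p , y∉p-x = x∈p⇒p-x⊂p x∈p in y∉p-x (subst (y ∈_) p≡p-x y∈p)

DomAdj-sym : {p q : Subset n} → DomAdj p q → DomAdj q p
DomAdj-sym {p = p} {q} = subst (λ r → ∣ r ∣ ≡ 1) (△-comm p q)

DomAdj-insertAt : {p q : Subset n} (i : Fin (suc n)) (s : Bool) →
                  DomAdj p q → DomAdj (insertAt p i s) (insertAt q i s)
DomAdj-insertAt {p = p} {q} i s p~q = begin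
  ∣ insertAt p i s △ insertAt q i s ∣ ≡⟨ cong ∣_∣ (insertAt-△ p q i s s) ⟩
  ∣ insertAt (p △ q) i (s xor s) ∣    ≡⟨ ∣insertAt∣ (p △ q) i (s xor s) ⟩
  ∣ (s xor s) ∷ p △ q ∣               ≡⟨ cong (λ b → ∣ b ∷ p △ q ∣) (xor-same s) ⟩
  ∣ p △ q ∣                           ≡⟨ p~q ⟩
  1                                   ∎
  where open ≡-Reasoning

DomAdj-insertAt-not : ∀ {n} (p : Subset n) (i : Fin (suc n)) (s : Bool) →
                      DomAdj (insertAt p i s) (insertAt p i (not s))
DomAdj-insertAt-not {n} p i s = begin
  ∣ insertAt p i s △ insertAt p i (not s) ∣ ≡⟨ cong ∣_∣ (insertAt-△ p p i s (not s)) ⟩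
  ∣ insertAt (p △ p) i (s xor not s) ∣      ≡⟨ ∣insertAt∣ (p △ p) i (s xor not s) ⟩
  ∣ (s xor not s) ∷ p △ p ∣                 ≡⟨ cong₂ (λ b r → ∣ b ∷ r ∣) (xor-inverseʳ s) (p△p≡⊥ p) ⟩
  ∣ inside ∷ ⊥ {n} ∣                        ≡⟨ cong suc (∣⊥∣≡0 n) ⟩
  1                                         ∎
  where open ≡-Reasoning

x∈p⇒DomAdj-p-x : {x : Fin n} {p : Subset n} → x ∈ p → DomAdj p (p - x)
x∈p⇒DomAdj-p-x {x = x} x∈p = trans (cong ∣_∣ (x∈p⇒p△p-x≡⁅x⁆ x∈p)) (∣⁅x⁆∣≡1 x)

dominating? : (G : Graph n) (D : Subset n) → Dec (Dominating G D)
dominating? G D = all? λ x → x ∈? D ⊎-dec any? λ y → y ∈? D ×-dec (Adj G x y Bool.≟ true)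

head-++ : ∀ {A : Set} {xs : List A} {a} (ys : List A) → head xs ≡ just a → head (xs ++ ys) ≡ just a
head-++ {xs = _ ∷ _} ys eq = eq

module _ {A B : Set} (column : Bool → A → List B) where

  snake : Bool → List A → List B
  snake b []       = []
  snake b (x ∷ xs) = column b x ++ snake (not b) xs

  snake-All : ∀ {P : A → Set} {Q : B → Set} → (∀ b x → P x → All Q (column b x)) →
              ∀ b {xs} → All P xs → All Q (snake b xs)
  snake-All Q-column b []         = []
  snake-All Q-column b (px ∷ pxs) = All-++⁺ (Q-column b _ px) (snake-All Q-column (not b) pxs)

  snake-∈ : ∀ b {x xs y} → x ∈ˡ xs → (∀ b → y ∈ˡ column b x) → y ∈ˡ snake b xs
  snake-∈ b {xs = x ∷ xs} (Any.here refl) y∈ = ∈-++⁺ˡ (y∈ b)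
  snake-∈ b {xs = x ∷ xs} (Any.there x∈)  y∈ = ∈-++⁺ʳ (column b x) (snake-∈ (not b) x∈ y∈)

  snake-Unique : ∀ {P : A → Set} (key : B → A) →
                 (∀ b x → P x → Unique (column b x)) →
                 (∀ b x → P x → All (λ y → key y ≡ x) (column b x)) →
                 ∀ b {xs} → All P xs → Unique xs → Unique (snake b xs)
  snake-Unique {P} key column-Unique column-key = go
    where
    keys : ∀ b {xs} → All P xs → All (λ y → key y ∈ˡ xs) (snake b xs)
    keys b []         = []
    keys b (px ∷ pxs) = All-++⁺ (All.map Any.here (column-key b _ px))
                                (All.map Any.there (keys (not b) pxs))

    disjoint : ∀ {x xs ys zs} → All (x ≢_) xs → All (λ y → key y ≡ x) ys → All (λ z → key z ∈ˡ xs) zs →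
               All (λ y → All (y ≢_) zs) ys
    disjoint x∉xs ys-key zs-key = All.map (λ key-y≡x → All.map (λ key-z∈xs y≡z →
      All.lookup x∉xs (subst (_∈ˡ _) (trans (cong key (sym y≡z)) key-y≡x) key-z∈xs) refl) zs-key) ys-key

    go : ∀ b {xs} → All P xs → Unique xs → Unique (snake b xs)
    go b []         []                 = []
    go b (px ∷ pxs) (x∉xs ∷ xs-unique) =
      AllPairs-++⁺ (column-Unique b _ px) (go (not b) pxs xs-unique)
                   (disjoint x∉xs (column-key b _ px) (keys (not b) pxs))

  snake-Linked : ∀ {P : A → Set} {R : A → A → Set} {S : B → B → Set} (start : Bool → A → B) →
                 (∀ b x → P x → Linked S (column b x)) →
                 (∀ b x → head (column b x) ≡ just (start b x)) →
                 (∀ b x → last (column b x) ≡ just (start (not b) x)) →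
                 (∀ b {x y} → R x y → S (start b x) (start b y)) →
                 ∀ b {xs} → All P xs → Linked R xs → Linked S (snake b xs)
  snake-Linked {P} {R} {S} start column-Linked column-head column-last start-R = go
    where
    go : ∀ b {xs} → All P xs → Linked R xs → Linked S (snake b xs)
    go b [] [] = []
    go b {x ∷ []} (px ∷ []) [-] =
      Linked-++⁺ (column-Linked b x px)
        (subst (λ end → Connected S end nothing) (sym (column-last b x)) just-nothing) []
    go b {x ∷ y ∷ xs} (px ∷ pxs) (x~y ∷ l) =
      Linked-++⁺ (column-Linked b x px)
        (subst₂ (Connected S) (sym (column-last b x)) (sym (head-++ _ (column-head (not b) y)))
          (just (start-R (not b) x~y)))
        (go (not b) pxs l)

module PendantPath {m} (H : Graph (suc (suc m))) (u v w : Fin (suc (suc m)))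
    (u≢v : u ≢ v) (u≢w : u ≢ w) (w≢v : w ≢ v)
    (N[v] : ∀ y → (v ∼[ H ] y) ⇔ (y ≡ u ⊎ y ≡ w))
    (N[w] : ∀ y → (w ∼[ H ] y) ⇔ (y ≡ v)) where

  H′ : Graph m
  H′ = deleteTwo H w v w≢v

  v′ : Fin (suc m)
  v′ = punchOut w≢v

  ι : Fin m → Fin (suc (suc m))
  ι a = punchIn w (punchIn v′ a)

  ι-injective : ∀ {a b} → ι a ≡ ι b → a ≡ b
  ι-injective eq = punchIn-injective v′ _ _ (punchIn-injective w _ _ eq)

  ι≢w : ∀ a → ι a ≢ w
  ι≢w a = punchInᵢ≢i w (punchIn v′ a)

  ι≢v : ∀ a → ι a ≢ v
  ι≢v a eq = punchInᵢ≢i v′ a (punchIn-injective w _ _ (trans eq (sym (punchIn-punchOut w≢v))))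

  data Position : Fin (suc (suc m)) → Set where
    at-w : Position w
    at-v : Position v
    at-ι : ∀ a → Position (ι a)

  position : ∀ x → Position x
  position x with x ≟ w
  ... | yes refl = at-w
  ... | no x≢w = subst Position (punchIn-punchOut w≢x) (below (punchOut w≢x))
    where
    w≢x : w ≢ x
    w≢x eq = x≢w (sym eq)
    below : ∀ j → Position (punchIn w j)
    below j with j ≟ v′
    ... | yes refl = subst Position (sym (punchIn-punchOut w≢v)) at-v
    ... | no j≢v′ = subst (λ k → Position (punchIn w k)) (punchIn-punchOut (λ eq → j≢v′ (sym eq))) (at-ι _)

  preimage : ∀ {x} → Position x → x ≢ w → x ≢ v → ∃ λ a → ι a ≡ x
  preimage at-w     x≢w _   = ⊥-elim (x≢w refl)
  preimage at-v     _   x≢v = ⊥-elim (x≢v refl)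
  preimage (at-ι a) _   _   = a , refl

  u′ : Fin m
  u′ = proj₁ (preimage (position u) u≢w u≢v)

  ι-u′ : ι u′ ≡ u
  ι-u′ = proj₂ (preimage (position u) u≢w u≢v)

  ∼-sym : ∀ {x y} → x ∼[ H ] y → y ∼[ H ] x
  ∼-sym {x} {y} x∼y = trans (Graph.sym H y x) x∼y

  w∼v : w ∼[ H ] v
  w∼v = Equivalence.from (N[w] v) refl

  v∼w : v ∼[ H ] w
  v∼w = ∼-sym w∼v

  ι≁w : ∀ a → ¬ (ι a ∼[ H ] w)
  ι≁w a ιa∼w = ι≢v a (Equivalence.to (N[w] (ι a)) (∼-sym ιa∼w))

  ι∼v⇒≡u′ : ∀ {a} → ι a ∼[ H ] v → a ≡ u′
  ι∼v⇒≡u′ {a} ιa∼v with Equivalence.to (N[v] (ι a)) (∼-sym ιa∼v)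
  ... | inj₁ ιa≡u = ι-injective (trans ιa≡u (sym ι-u′))
  ... | inj₂ ιa≡w = ⊥-elim (ι≢w a ιa≡w)

  extend : Subset m → Bool → Bool → Subset (suc (suc m))
  extend D s t = insertAt (insertAt D v′ t) w s

  restrict : Subset (suc (suc m)) → Subset m
  restrict X = removeAt (removeAt X w) v′

  lookup-extend-w : ∀ D s t → lookup (extend D s t) w ≡ s
  lookup-extend-w D s t = insertAt-lookup (insertAt D v′ t) w s

  lookup-extend-v : ∀ D s t → lookup (extend D s t) v ≡ t
  lookup-extend-v D s t = begin
    lookup (extend D s t) v              ≡⟨ cong (lookup (extend D s t)) (sym (punchIn-punchOut w≢v)) ⟩
    lookup (extend D s t) (punchIn w v′) ≡⟨ insertAt-punchIn (insertAt D v′ t) w s v′ ⟩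
    lookup (insertAt D v′ t) v′          ≡⟨ insertAt-lookup D v′ t ⟩
    t                                    ∎
    where open ≡-Reasoning

  lookup-extend-ι : ∀ D s t a → lookup (extend D s t) (ι a) ≡ lookup D a
  lookup-extend-ι D s t a = trans (insertAt-punchIn (insertAt D v′ t) w s _) (insertAt-punchIn D v′ t a)

  restrict-extend : ∀ D s t → restrict (extend D s t) ≡ D
  restrict-extend D s t =
    trans (cong (λ X → removeAt X v′) (removeAt-insertAt _ w s)) (removeAt-insertAt D v′ t)

  extend-restrict : ∀ X → extend (restrict X) (lookup X w) (lookup X v) ≡ X
  extend-restrict X = begin
      insertAt (insertAt (restrict X) v′ (lookup X v)) w (lookup X w)
    ≡⟨ cong (λ t → insertAt (insertAt (restrict X) v′ t) w (lookup X w)) (sym (removeAt-punchOut X w≢v)) ⟩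
      insertAt (insertAt (restrict X) v′ (lookup (removeAt X w) v′)) w (lookup X w)
    ≡⟨ cong (λ Y → insertAt Y w (lookup X w)) (insertAt-removeAt (removeAt X w) v′) ⟩
      insertAt (removeAt X w) w (lookup X w)
    ≡⟨ insertAt-removeAt X w ⟩
      X
    ∎
    where open ≡-Reasoning

  extend-injective : ∀ {D D′ s s′ t t′} → extend D s t ≡ extend D′ s′ t′ → D ≡ D′ × s ≡ s′ × t ≡ t′
  extend-injective {D} {D′} {s} {s′} {t} {t′} eq =
      trans (sym (restrict-extend D s t)) (trans (cong restrict eq) (restrict-extend D′ s′ t′))
    , trans (sym (lookup-extend-w D s t)) (trans (cong (λ X → lookup X w) eq) (lookup-extend-w D′ s′ t′))
    , trans (sym (lookup-extend-v D s t)) (trans (cong (λ X → lookup X v) eq) (lookup-extend-v D′ s′ t′))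

  w∈extend : ∀ {D t} → w ∈ extend D true t
  w∈extend {D} {t} = lookup⇒[]= w _ (lookup-extend-w D true t)

  v∈extend : ∀ {D s} → v ∈ extend D s true
  v∈extend {D} {s} = lookup⇒[]= v _ (lookup-extend-v D s true)

  ι∈extend : ∀ {D s t a} → a ∈ D → ι a ∈ extend D s t
  ι∈extend {D} {s} {t} {a} a∈D = lookup⇒[]= (ι a) _ (trans (lookup-extend-ι D s t a) ([]=⇒lookup a∈D))

  w∈extend⁻ : ∀ {D s t} → w ∈ extend D s t → s ≡ true
  w∈extend⁻ {D} {s} {t} w∈ = trans (sym (lookup-extend-w D s t)) ([]=⇒lookup w∈)

  v∈extend⁻ : ∀ {D s t} → v ∈ extend D s t → t ≡ true
  v∈extend⁻ {D} {s} {t} v∈ = trans (sym (lookup-extend-v D s t)) ([]=⇒lookup v∈)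

  ι∈extend⁻ : ∀ {D s t a} → ι a ∈ extend D s t → a ∈ D
  ι∈extend⁻ {D} {s} {t} {a} ιa∈ = lookup⇒[]= a D (trans (sym (lookup-extend-ι D s t a)) ([]=⇒lookup ιa∈))

  extend-dominating : ∀ {D s t} → Dominating H′ D → s ≡ true ⊎ t ≡ true → Dominating H (extend D s t)
  extend-dominating D-dom s∨t x with position x | s∨t
  ... | at-w   | inj₁ refl = inj₁ w∈extend
  ... | at-w   | inj₂ refl = inj₂ (v , v∈extend , w∼v)
  ... | at-v   | inj₁ refl = inj₂ (w , w∈extend , v∼w)
  ... | at-v   | inj₂ refl = inj₁ v∈extend
  ... | at-ι a | _ with D-dom a
  ...   | inj₁ a∈D              = inj₁ (ι∈extend a∈D)
  ...   | inj₂ (b , b∈D , a∼b) = inj₂ (ι b , ι∈extend b∈D , a∼b)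

  restrict-dominating : ∀ {E s t F} → Dominating H (extend E s t) → E ⊆ F → (t ≡ true → u′ ∈ F) →
                        Dominating H′ F
  restrict-dominating dom E⊆F t⇒u′∈F a with dom (ι a)
  ... | inj₁ ιa∈ = inj₁ (E⊆F (ι∈extend⁻ ιa∈))
  ... | inj₂ (y , y∈ , ιa∼y) with position y
  ...   | at-w   = ⊥-elim (ι≁w a ιa∼y)
  ...   | at-v   = inj₁ (subst (_∈ _) (sym (ι∼v⇒≡u′ ιa∼y)) (t⇒u′∈F (v∈extend⁻ y∈)))
  ...   | at-ι b = inj₂ (b , E⊆F (ι∈extend⁻ y∈) , ιa∼y)

  -- Once v is in the set it dominates w, and w has no other neighbour to serve.
  extend-dominating-any-w : ∀ {E s} s′ → Dominating H (extend E s true) → Dominating H (extend E s′ true)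
  extend-dominating-any-w s′ dom x with position x
  ... | at-w   = inj₂ (v , v∈extend , w∼v)
  ... | at-v   = inj₁ v∈extend
  ... | at-ι a with dom (ι a)
  ...   | inj₁ ιa∈ = inj₁ (ι∈extend (ι∈extend⁻ ιa∈))
  ...   | inj₂ (y , y∈ , ιa∼y) with position y
  ...     | at-w   = ⊥-elim (ι≁w a ιa∼y)
  ...     | at-v   = inj₂ (v , v∈extend , ιa∼y)
  ...     | at-ι b = inj₂ (ι b , ι∈extend (ι∈extend⁻ y∈) , ιa∼y)

  extend-false-false : ∀ {E} → ¬ Dominating H (extend E false false)
  extend-false-false dom with dom w
  ... | inj₁ w∈ with () ← w∈extend⁻ w∈
  ... | inj₂ (y , y∈ , w∼y) with Equivalence.to (N[w] y) w∼y
  ...   | refl with () ← v∈extend⁻ y∈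

  Twinned : Subset m → Set
  Twinned D = Dominating H (extend (D - u′) true true) × ¬ Dominating H′ (D - u′)

  twinned? : ∀ D → Dec (Twinned D)
  twinned? D = dominating? H (extend (D - u′) true true) ×-dec ¬? (dominating? H′ (D - u′))

  twinned⇒u′∈ : ∀ {D} → Dominating H′ D → Twinned D → u′ ∈ D
  twinned⇒u′∈ {D} D-dom (_ , ¬dom) with u′ ∈? D
  ... | yes u′∈D = u′∈D
  ... | no  u′∉D = ⊥-elim (¬dom (subst (Dominating H′) (sym (x∉p⇒p-x≡p u′∉D)) D-dom))

  -- The D whose column holds the extensions of E: E itself, or E + u when E = D − u for a twinned D.
  owner : Subset m → Subset m
  owner E with dominating? H′ E
  ... | yes _ = E
  ... | no  _ = E ∪ ⁅ u′ ⁆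

  owner-dominating : ∀ {D} → Dominating H′ D → owner D ≡ D
  owner-dominating {D} D-dom with dominating? H′ D
  ... | yes _   = refl
  ... | no ¬dom = ⊥-elim (¬dom D-dom)

  owner-twin : ∀ {D} → Dominating H′ D → Twinned D → owner (D - u′) ≡ D
  owner-twin {D} D-dom twin with dominating? H′ (D - u′)
  ... | yes dom = ⊥-elim (proj₂ twin dom)
  ... | no  _   = x∈p⇒p-x∪⁅x⁆≡p (twinned⇒u′∈ D-dom twin)

  start : Bool → Subset m → Subset (suc (suc m))
  start true  D = extend D true false
  start false D = extend D false true

  column′ : Bool → (D : Subset m) → Dec (Twinned D) → List (Subset (suc (suc m)))
  column′ true  D (yes _) = extend D true false ∷ extend D true true ∷ extend (D - u′) true true
                          ∷ extend (D - u′) false true ∷ extend D false true ∷ []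
  column′ true  D (no _)  = extend D true false ∷ extend D true true ∷ extend D false true ∷ []
  column′ false D (yes _) = extend D false true ∷ extend (D - u′) false true ∷ extend (D - u′) true true
                          ∷ extend D true true ∷ extend D true false ∷ []
  column′ false D (no _)  = extend D false true ∷ extend D true true ∷ extend D true false ∷ []

  column : Bool → Subset m → List (Subset (suc (suc m)))
  column b D = column′ b D (twinned? D)

  column-head : ∀ b D → head (column b D) ≡ just (start b D)
  column-head b D with twinned? D | b
  ... | yes _ | true  = refl
  ... | yes _ | false = refl
  ... | no  _ | true  = refl
  ... | no  _ | false = refl

  column-last : ∀ b D → last (column b D) ≡ just (start (not b) D)
  column-last b D with twinned? D | b
  ... | yes _ | true  = refl
  ... | yes _ | false = refl
  ... | no  _ | true  = refl
  ... | no  _ | false = refl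

  column-dominating : ∀ b D → Dominating H′ D → All (Dominating H) (column b D)
  column-dominating b D D-dom = go b (twinned? D)
    where
    up₁ : ∀ {t} → Dominating H (extend D true t)
    up₁ = extend-dominating D-dom (inj₁ refl)
    up₂ : ∀ {s} → Dominating H (extend D s true)
    up₂ = extend-dominating D-dom (inj₂ refl)
    go : ∀ b d → All (Dominating H) (column′ b D d)
    go true  (yes (twin-dom , _)) = up₁ ∷ up₁ ∷ twin-dom ∷ extend-dominating-any-w false twin-dom ∷ up₂ ∷ []
    go false (yes (twin-dom , _)) = up₂ ∷ extend-dominating-any-w false twin-dom ∷ twin-dom ∷ up₁ ∷ up₁ ∷ []
    go true  (no _)               = up₁ ∷ up₁ ∷ up₂ ∷ []
    go false (no _)               = up₂ ∷ up₁ ∷ up₁ ∷ []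

  extend-DomAdj : ∀ {D D′} s t → DomAdj D D′ → DomAdj (extend D s t) (extend D′ s t)
  extend-DomAdj s t D~D′ = DomAdj-insertAt w s (DomAdj-insertAt v′ t D~D′)

  flip-w : ∀ D s t → DomAdj (extend D s t) (extend D (not s) t)
  flip-w D s t = DomAdj-insertAt-not (insertAt D v′ t) w s

  flip-v : ∀ D s t → DomAdj (extend D s t) (extend D s (not t))
  flip-v D s t = DomAdj-insertAt w s (DomAdj-insertAt-not D v′ t)

  start-DomAdj : ∀ b {D D′} → DomAdj D D′ → DomAdj (start b D) (start b D′)
  start-DomAdj true  = extend-DomAdj true false
  start-DomAdj false = extend-DomAdj false true

  column-Linked : ∀ b D → Dominating H′ D → Linked DomAdj (column b D)
  column-Linked b D D-dom = go b (twinned? D)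
    where
    D~D-u′ : Twinned D → DomAdj D (D - u′)
    D~D-u′ twin = x∈p⇒DomAdj-p-x (twinned⇒u′∈ D-dom twin)
    go : ∀ b d → Linked DomAdj (column′ b D d)
    go true  (yes twin) = flip-v D true false ∷ extend-DomAdj true true (D~D-u′ twin)
                        ∷ flip-w (D - u′) true true ∷ extend-DomAdj false true (DomAdj-sym {p = D} (D~D-u′ twin)) ∷ [-]
    go false (yes twin) = extend-DomAdj false true (D~D-u′ twin) ∷ flip-w (D - u′) false true
                        ∷ extend-DomAdj true true (DomAdj-sym {p = D} (D~D-u′ twin)) ∷ flip-v D true true ∷ [-]
    go true  (no _)     = flip-v D true false ∷ flip-w D true true ∷ [-]
    go false (no _)     = flip-w D false true ∷ flip-v D true true ∷ [-]

  ≢-at-w : ∀ {D D′ s s′ t t′} → s ≢ s′ → extend D s t ≢ extend D′ s′ t′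
  ≢-at-w s≢s′ eq = s≢s′ (proj₁ (proj₂ (extend-injective eq)))

  ≢-at-v : ∀ {D D′ s s′ t t′} → t ≢ t′ → extend D s t ≢ extend D′ s′ t′
  ≢-at-v t≢t′ eq = t≢t′ (proj₂ (proj₂ (extend-injective eq)))

  ≢-off-w-v : ∀ {D D′ s s′ t t′} → D ≢ D′ → extend D s t ≢ extend D′ s′ t′
  ≢-off-w-v D≢D′ eq = D≢D′ (proj₁ (extend-injective eq))

  column-Unique : ∀ b D → Dominating H′ D → Unique (column b D)
  column-Unique b D D-dom = go b (twinned? D)
    where
    t≢f : true ≢ false
    t≢f ()
    f≢t : false ≢ true
    f≢t ()
    D≢D-u′ : Twinned D → D ≢ D - u′
    D≢D-u′ twin = x∈p⇒p≢p-x (twinned⇒u′∈ D-dom twin)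
    go : ∀ b d → Unique (column′ b D d)
    go true  (yes twin) =
          (≢-at-v f≢t ∷ ≢-at-v f≢t ∷ ≢-at-w t≢f ∷ ≢-at-w t≢f ∷ [])
        ∷ (≢-off-w-v (D≢D-u′ twin) ∷ ≢-at-w t≢f ∷ ≢-at-w t≢f ∷ [])
        ∷ (≢-at-w t≢f ∷ ≢-at-w t≢f ∷ [])
        ∷ (≢-off-w-v (≢-sym (D≢D-u′ twin)) ∷ [])
        ∷ [] ∷ []
    go false (yes twin) =
          (≢-off-w-v (D≢D-u′ twin) ∷ ≢-at-w f≢t ∷ ≢-at-w f≢t ∷ ≢-at-w f≢t ∷ [])
        ∷ (≢-at-w f≢t ∷ ≢-at-w f≢t ∷ ≢-at-w f≢t ∷ [])
        ∷ (≢-off-w-v (≢-sym (D≢D-u′ twin)) ∷ ≢-at-v t≢f ∷ [])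
        ∷ (≢-at-v t≢f ∷ [])
        ∷ [] ∷ []
    go true  (no _) = (≢-at-v f≢t ∷ ≢-at-w t≢f ∷ []) ∷ (≢-at-w t≢f ∷ []) ∷ [] ∷ []
    go false (no _) = (≢-at-w f≢t ∷ ≢-at-w f≢t ∷ []) ∷ (≢-at-v t≢f ∷ []) ∷ [] ∷ []

  column-owner : ∀ b D → Dominating H′ D → All (λ X → owner (restrict X) ≡ D) (column b D)
  column-owner b D D-dom = go b (twinned? D)
    where
    owns : ∀ {s t} → owner (restrict (extend D s t)) ≡ D
    owns {s} {t} = trans (cong owner (restrict-extend D s t)) (owner-dominating D-dom)
    owns-twin : Twinned D → ∀ {s t} → owner (restrict (extend (D - u′) s t)) ≡ D
    owns-twin twin {s} {t} = trans (cong owner (restrict-extend (D - u′) s t)) (owner-twin D-dom twin)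
    go : ∀ b d → All (λ X → owner (restrict X) ≡ D) (column′ b D d)
    go true  (yes twin) = owns ∷ owns ∷ owns-twin twin ∷ owns-twin twin ∷ owns ∷ []
    go false (yes twin) = owns ∷ owns-twin twin ∷ owns-twin twin ∷ owns ∷ owns ∷ []
    go true  (no _)     = owns ∷ owns ∷ owns ∷ []
    go false (no _)     = owns ∷ owns ∷ owns ∷ []

  extend-true-false∈column : ∀ b D → extend D true false ∈ˡ column b D
  extend-true-false∈column b D with twinned? D | b
  ... | yes _ | true  = Any.here refl
  ... | yes _ | false = Any.there (Any.there (Any.there (Any.there (Any.here refl))))
  ... | no  _ | true  = Any.here refl
  ... | no  _ | false = Any.there (Any.there (Any.here refl))

  extend-true∈column : ∀ s b D → extend D s true ∈ˡ column b D
  extend-true∈column s b D with twinned? D | b | s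
  ... | yes _ | true  | true  = Any.there (Any.here refl)
  ... | yes _ | true  | false = Any.there (Any.there (Any.there (Any.there (Any.here refl))))
  ... | yes _ | false | true  = Any.there (Any.there (Any.there (Any.here refl)))
  ... | yes _ | false | false = Any.here refl
  ... | no  _ | true  | true  = Any.there (Any.here refl)
  ... | no  _ | true  | false = Any.there (Any.there (Any.here refl))
  ... | no  _ | false | true  = Any.there (Any.here refl)
  ... | no  _ | false | false = Any.here refl

  twin-extend∈column : ∀ s b D → Twinned D → extend (D - u′) s true ∈ˡ column b D
  twin-extend∈column s b D twin with twinned? D | b | s
  ... | no ¬twin | _     | _     = ⊥-elim (¬twin twin)
  ... | yes _    | true  | true  = Any.there (Any.there (Any.here refl))
  ... | yes _    | true  | false = Any.there (Any.there (Any.there (Any.here refl)))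
  ... | yes _    | false | true  = Any.there (Any.there (Any.here refl))
  ... | yes _    | false | false = Any.there (Any.here refl)

  -- A set containing v but not dominating H′ can only miss u′, so adding u′ repairs it.
  extend-covered : ∀ E s t → Dominating H (extend E s t) →
                   ∃ λ D → Dominating H′ D × ∀ b → extend E s t ∈ˡ column b D
  extend-covered E false false dom = ⊥-elim (extend-false-false dom)
  extend-covered E true  false dom =
    E , restrict-dominating dom (λ x∈E → x∈E) (λ ()) , λ b → extend-true-false∈column b E
  extend-covered E s true dom with dominating? H′ E
  ... | yes E-dom = E , E-dom , λ b → extend-true∈column s b E
  ... | no ¬E-dom = E ∪ ⁅ u′ ⁆ , D-dom ,
        λ b → subst (λ F → extend F s true ∈ˡ column b (E ∪ ⁅ u′ ⁆)) D-u′≡E (twin-extend∈column s b _ twin)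
    where
    u′∉E : u′ ∉ E
    u′∉E u′∈E = ¬E-dom (restrict-dominating dom (λ x∈E → x∈E) (λ _ → u′∈E))
    D-u′≡E : (E ∪ ⁅ u′ ⁆) - u′ ≡ E
    D-u′≡E = x∉p⇒p∪⁅x⁆-x≡p u′∉E
    D-dom : Dominating H′ (E ∪ ⁅ u′ ⁆)
    D-dom = restrict-dominating dom (p⊆p∪q ⁅ u′ ⁆) (λ _ → x∈p∪q⁺ (inj₂ (x∈⁅x⁆ u′)))
    twin : Twinned (E ∪ ⁅ u′ ⁆)
    twin = subst (λ F → Dominating H (extend F true true) × ¬ Dominating H′ F) (sym D-u′≡E)
                 (extend-dominating-any-w true dom , ¬E-dom)

  covered : ∀ X → Dominating H X → ∃ λ D → Dominating H′ D × ∀ b → X ∈ˡ column b D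
  covered X X-dom =
    let D , D-dom , X∈column = extend-covered (restrict X) (lookup X w) (lookup X v)
                                 (subst (Dominating H) (sym (extend-restrict X)) X-dom)
    in D , D-dom , λ b → subst (_∈ˡ column b D) (extend-restrict X) (X∈column b)

lemma2p2 : ∀ {m} (H : Graph (suc (suc m))) (u v w : Fin (suc (suc m))) →
    u ≢ v → u ≢ w → (w≢v : w ≢ v) →
    (∀ y → (v ∼[ H ] y) ⇔ (y ≡ u ⊎ y ≡ w)) →
    (∀ y → (w ∼[ H ] y) ⇔ (y ≡ v)) →
    HamiltonPathDom (deleteTwo H w v w≢v) →
    HamiltonPathDom H
lemma2p2 H u v w u≢v u≢w w≢v N[v] N[w] (P , P-dominating , P-unique , P-complete , P-linked) =
    snake column true P
  , snake-All column column-dominating true P-dominating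
  , snake-Unique column (owner ∘ restrict) column-Unique column-owner true P-dominating P-unique
  , (λ X X-dom → let D , D-dom , X∈column = covered X X-dom
                 in snake-∈ column true (P-complete D D-dom) X∈column)
  , snake-Linked column start column-Linked column-head column-last start-DomAdj true P-dominating P-linked
  where open PendantPath H u v w u≢v u≢w w≢v N[v] N[w]
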